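{- Let $A=(1,a_1,\ldots,a_k)$ be an orderly currency, with the convention $a_{k+1}=\infty$. If $0\leq i<j\leq k$ and $0\leq l<m\leq k$ satisfy $a_m-a_{l+1}<a_j-a_i<a_m-a_l$, then $a_{j+1}\leq a_i+a_m$.
   Context: A currency is a finite sequence of integers $A=(a_0,a_1,\ldots,a_k)$ with $1=a_0<a_1<\cdots<a_k$. For an integer amount $c>0$, $\mathrm{opt}_A(c)$ is the minimum number of coins (values from $A$, repetitions allowed) summing to $c$, and $\mathrm{grd}_A(c)$ is the number of coins used by the greedy algorithm, which repeatedly takes the largest coin not exceeding the remaining amount. $A$ is orderly if $\mathrm{opt}_A(c)=\mathrm{grd}_A(c)$ for all integers $c>0$. By convention $a_{k+1}=\infty$ (so the conclusion in particular forces $j<k$). -}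

module Defs where

open import Data.Nat using (ℕ; zero; suc; _+_; _∸_; _≤_; _<_; _≤?_)
open import Data.Fin using (Fin; toℕ; fromℕ; inject₁)
open import Data.List using (List; []; _∷_; length; map)
open import Data.Nat.ListAction using (sum)
open import Data.Product using (Σ; _×_; _,_)
open import Relation.Binary.PropositionalEquality using (_≡_)
open import Relation.Nullary using (yes; no)

record IsCurrency (k : ℕ) (a : Fin (suc k) → ℕ) : Set where
  field
    first-one  : a Data.Fin.zero ≡ 1
    increasing : ∀ (i j : Fin (suc k)) → toℕ i < toℕ j → a i < a j

IsRep : ∀ {k} → (Fin (suc k) → ℕ) → ℕ → List (Fin (suc k)) → Set
IsRep a c cs = sum (map a cs) ≡ c

IsOpt : ∀ {k} → (Fin (suc k) → ℕ) → ℕ → ℕ → Set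
IsOpt {k} a c n =
  (Σ (List (Fin (suc k))) λ cs → IsRep a c cs × length cs ≡ n)
  × (∀ (cs : List (Fin (suc k))) → IsRep a c cs → n ≤ length cs)

-- Largest coin not exceeding r, searching indices i, i-1, ..., 0.
-- Returns the coin value (0 if none, which cannot happen for r ≥ 1 since a 0 = 1).
largestFrom : ∀ {k} → (Fin (suc k) → ℕ) → (n : ℕ) → (Fin (suc n) → Fin (suc k)) → ℕ → ℕ
largestFrom a zero idx r with a (idx Data.Fin.zero) ≤? r
... | yes _ = a (idx Data.Fin.zero)
... | no _  = 0
largestFrom a (suc n) idx r with a (idx (fromℕ (suc n))) ≤? r
... | yes _ = a (idx (fromℕ (suc n)))
... | no _  = largestFrom a n (λ x → idx (inject₁ x)) r

largestCoin : ∀ {k} → (Fin (suc k) → ℕ) → ℕ → ℕ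
largestCoin {k} a r = largestFrom a k (λ x → x) r

-- Greedy: repeatedly take the largest coin ≤ remaining amount; fuel bounds the
-- number of steps (each step removes at least 1 since a 0 = 1).
grdFuel : ∀ {k} → (Fin (suc k) → ℕ) → ℕ → ℕ → ℕ
grdFuel a zero r = 0
grdFuel a (suc f) zero = 0
grdFuel a (suc f) (suc r) = suc (grdFuel a f (suc r ∸ largestCoin a (suc r)))

grd : ∀ {k} → (Fin (suc k) → ℕ) → ℕ → ℕ
grd a c = grdFuel a c c

Orderly : ∀ {k} → (Fin (suc k) → ℕ) → Set
Orderly a = ∀ (c : ℕ) → 0 < c → IsOpt a c (grd a c)

module Submission where

-- Put c = a i + a m.  Since c is a sum of two coins and the
-- currency is orderly, the greedy algorithm pays c with at most two coins.
-- Suppose every coin with index above j exceeds c (this includes the case j = k).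
-- As a j < c, greedy first takes a j and is left with r = c - a j = a m - (a j - a i);
-- the two hypotheses say precisely that a l < r < a (l+1), so r is not a coin value.
-- Greedy's second coin is therefore strictly smaller than r, a third coin is needed,
-- and grd c ≥ 3: a contradiction.  Hence a (j+1) exists and does not exceed c.

open import Defs
open import Data.Nat using (ℕ; zero; suc; _+_; _∸_; _≤_; _<_; s≤s; z≤n; _≤?_; _<?_; s≤s⁻¹)
open import Data.Nat.Properties
open import Data.Fin using (Fin; toℕ; fromℕ<; fromℕ; inject₁)
open import Data.Fin.Properties using (toℕ-injective; toℕ-inject₁; toℕ-fromℕ<; toℕ<n; ≤fromℕ)
open import Data.Fin.Relation.Unary.Top using (view; ‵fromℕ; ‵inj₁)
open import Data.List using ([]; _∷_; length)
open import Data.Product using (Σ; _×_; _,_; proj₁; proj₂)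
open import Data.Sum using (inj₁; inj₂)
open import Function using (id)
open import Relation.Nullary using (yes; no; ¬_; contradiction)
open import Relation.Binary.PropositionalEquality using (_≡_; _≢_; refl; sym; cong; subst; subst₂; module ≡-Reasoning)

module _ {k : ℕ} (a : Fin (suc k) → ℕ) where

  data LargestView (n : ℕ) (idx : Fin (suc n) → Fin (suc k)) (r : ℕ) : ℕ → Set where
    found : (t : Fin (suc n)) → a (idx t) ≤ r → (∀ u → toℕ t < toℕ u → r < a (idx u)) →
            LargestView n idx r (a (idx t))
    none  : (∀ u → r < a (idx u)) → LargestView n idx r 0

  largestView : ∀ n idx r → LargestView n idx r (largestFrom a n idx r)
  largestView zero idx r with a (idx Fin.zero) ≤? r
  ... | yes fits = found Fin.zero fits (λ { Fin.zero () })
  ... | no  big  = none (λ { Fin.zero → ≰⇒> big })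
  largestView (suc n) idx r with a (idx (fromℕ (suc n))) ≤? r
  ... | yes fits = found (fromℕ (suc n)) fits (λ u lt → contradiction (≤fromℕ u) (<⇒≱ lt))
  ... | no  big with largestFrom a n (λ v → idx (inject₁ v)) r | largestView n (λ v → idx (inject₁ v)) r
  ...   | _ | found t fits above = found (inject₁ t) fits above′
    where
    above′ : ∀ u → toℕ (inject₁ t) < toℕ u → r < a (idx u)
    above′ u lt with view u
    ... | ‵fromℕ       = ≰⇒> big
    ... | ‵inj₁ {i = v} _ = above v (subst₂ _<_ (toℕ-inject₁ t) (toℕ-inject₁ v) lt)
  ...   | _ | none above = none above′
    where
    above′ : ∀ u → r < a (idx u)
    above′ u with view u
    ... | ‵fromℕ       = ≰⇒> big
    ... | ‵inj₁ {i = v} _ = above v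

  largestCoinView : ∀ r → LargestView k id r (largestCoin a r)
  largestCoinView r = largestView k id r

  largestCoin-picks : ∀ {r} t → a t ≤ r → (∀ u → toℕ t < toℕ u → r < a u) →
                      largestCoin a r ≡ a t
  largestCoin-picks {r} t fits above with largestCoin a r | largestCoinView r
  ... | _ | none all = contradiction fits (<⇒≱ (all t))
  ... | _ | found s fits′ above′ = cong a (toℕ-injective (≤-antisym s≤t t≤s))
    where
    s≤t : toℕ s ≤ toℕ t
    s≤t = ≮⇒≥ (λ t<s → <⇒≱ (above s t<s) fits′)
    t≤s : toℕ t ≤ toℕ s
    t≤s = ≮⇒≥ (λ s<t → <⇒≱ (above′ t s<t) fits)

  remainder : ℕ → ℕ
  remainder r = r ∸ largestCoin a r

  remainder-pos : ∀ {r} → 0 < r → (∀ t → a t ≢ r) → 0 < remainder r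
  remainder-pos {r} r>0 notCoin with largestCoin a r | largestCoinView r
  ... | _ | none _ = r>0
  ... | _ | found t fits _ = m<n⇒0<n∸m (≤∧≢⇒< fits (notCoin t))

  greedy-step : ∀ f r → 0 < r → grdFuel a (suc f) r ≡ suc (grdFuel a f (remainder r))
  greedy-step f (suc r) _ = refl

  grd-≥3 : ∀ {c} → 3 ≤ c → 0 < remainder c → 0 < remainder (remainder c) → 3 ≤ grd a c
  grd-≥3 {c} c≥3 rem₁>0 rem₂>0 =
    subst (λ f → 3 ≤ grdFuel a f c) (m+[n∸m]≡n c≥3) (three-steps (c ∸ 3))
    where
    three-steps : ∀ f → 3 ≤ grdFuel a (3 + f) c
    three-steps f
      rewrite greedy-step (2 + f) c (≤-trans (s≤s z≤n) c≥3)
            | greedy-step (1 + f) (remainder c) rem₁>0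
            | greedy-step f (remainder (remainder c)) rem₂>0 = s≤s (s≤s (s≤s z≤n))

  grd-≤-rep : Orderly a → ∀ {c} → 0 < c → ∀ cs → IsRep a c cs → grd a c ≤ length cs
  grd-≤-rep ord c>0 cs rep = proj₂ (ord _ c>0) cs rep

module _ {k : ℕ} {a : Fin (suc k) → ℕ} (cur : IsCurrency k a) where
  open IsCurrency cur

  coin-mono : ∀ t u → toℕ t ≤ toℕ u → a t ≤ a u
  coin-mono t u t≤u with m≤n⇒m<n∨m≡n t≤u
  ... | inj₁ t<u = <⇒≤ (increasing t u t<u)
  ... | inj₂ t≡u rewrite toℕ-injective t≡u = ≤-refl

  coin-pos : ∀ u → 0 < a u
  coin-pos u = subst (_≤ a u) first-one (coin-mono Fin.zero u z≤n)

  next-≤ : ∀ (j : Fin (suc k)) (jk : toℕ j < k) u → toℕ j < toℕ u → a (fromℕ< (s≤s jk)) ≤ a u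
  next-≤ j jk u j<u = coin-mono _ u (subst (_≤ toℕ u) (sym (toℕ-fromℕ< (s≤s jk))) j<u)

  between-not-coin : ∀ (l : Fin (suc k)) {r} (lk : toℕ l < k) → a l < r → r < a (fromℕ< (s≤s lk)) →
                     ∀ t → a t ≢ r
  between-not-coin l lk al<r r<next t refl with toℕ t ≤? toℕ l
  ... | yes t≤l = <-irrefl refl (≤-<-trans (coin-mono t l t≤l) al<r)
  ... | no  t≰l = <-irrefl refl (<-≤-trans r<next (next-≤ l lk t (≰⇒> t≰l)))

∸-between : ∀ {M L L′ d} → M ∸ L′ < d → d < M ∸ L → d < M × L < M ∸ d × M ∸ d < L′
∸-between {M} {L} {L′} {d} lo hi = d<M , L<M∸d , M∸d<L′
  where
  d<M : d < M
  d<M = <-≤-trans hi (m∸n≤m M L)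
  L<M : L < M
  L<M = ∸-cancelʳ-< {M} {L} {M} (subst (_< M ∸ L) (sym (n∸n≡0 M)) (≤-<-trans z≤n hi))
  L<M∸d : L < M ∸ d
  L<M∸d = m+n≤o⇒m≤o∸n (suc L) (subst (_≤ M) (cong suc (+-comm d L)) (m≤o∸n⇒m+n≤o (suc d) (<⇒≤ L<M) hi))
  M∸d<L′ : M ∸ d < L′
  M∸d<L′ = +-cancelʳ-< d (M ∸ d) L′
             (subst (_< L′ + d) (sym (m∸n+n≡m (<⇒≤ d<M))) (≤-<-trans (m≤n+m∸n M L′) (+-monoʳ-< L′ lo)))

+-∸-shift : ∀ {x y} M → x ≤ y → (x + M) ∸ y ≡ M ∸ (y ∸ x)
+-∸-shift {x} {y} M x≤y = begin
  (x + M) ∸ y              ≡⟨ cong ((x + M) ∸_) (sym (m+[n∸m]≡n x≤y)) ⟩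
  (x + M) ∸ (x + (y ∸ x))  ≡⟨ [m+n]∸[m+o]≡n∸o x M (y ∸ x) ⟩
  M ∸ (y ∸ x)              ∎
  where open ≡-Reasoning

remainder-in-gap : ∀ {x y M L L′} → x ≤ y → M ∸ L′ < y ∸ x → y ∸ x < M ∸ L →
                   y < x + M × L < (x + M) ∸ y × (x + M) ∸ y < L′
remainder-in-gap {x} {y} {M} {L} {L′} x≤y lo hi =
  subst (_< x + M) (m+[n∸m]≡n x≤y) (+-monoʳ-< x d<M) ,
  subst (L <_) (sym rest≡) L<rest ,
  subst (_< L′) (sym rest≡) rest<L′
  where
  rest≡ : (x + M) ∸ y ≡ M ∸ (y ∸ x)
  rest≡ = +-∸-shift M x≤y
  between : y ∸ x < M × L < M ∸ (y ∸ x) × M ∸ (y ∸ x) < L′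
  between = ∸-between {M} {L} {L′} {y ∸ x} lo hi
  d<M : y ∸ x < M
  d<M = proj₁ between
  L<rest : L < M ∸ (y ∸ x)
  L<rest = proj₁ (proj₂ between)
  rest<L′ : M ∸ (y ∸ x) < L′
  rest<L′ = proj₂ (proj₂ between)

-- The core contradiction: under the hypotheses of the lemma it is impossible that
-- every coin after index j exceeds c = a i + a m, since greedy would then pay c with
-- three coins.
coin-above-exceeds : ∀ {k} {a : Fin (suc k) → ℕ} → IsCurrency k a → Orderly a →
  (i j l m : Fin (suc k)) → toℕ i < toℕ j → (lk : toℕ l < k) →
  a m ∸ a (fromℕ< (s≤s lk)) < a j ∸ a i → a j ∸ a i < a m ∸ a l →
  ¬ (∀ u → toℕ j < toℕ u → a i + a m < a u)
coin-above-exceeds {a = a} cur ord i j l m i<j lk lo hi above = <⇒≱ grd≥3 grd≤2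
  where
  open IsCurrency cur
  c : ℕ
  c = a i + a m
  gap : a j < c × a l < c ∸ a j × c ∸ a j < a (fromℕ< (s≤s lk))
  gap = remainder-in-gap (<⇒≤ (increasing i j i<j)) lo hi
  aj<c : a j < c
  aj<c = proj₁ gap
  first-coin : largestCoin a c ≡ a j
  first-coin = largestCoin-picks a j (<⇒≤ aj<c) above
  rest-between : a l < c ∸ a j × c ∸ a j < a (fromℕ< (s≤s lk))
  rest-between = proj₂ gap
  rest-pos : 0 < remainder a c
  rest-pos rewrite first-coin = ≤-<-trans z≤n (proj₁ rest-between)
  rest₂-pos : 0 < remainder a (remainder a c)
  rest₂-pos rewrite first-coin =
    remainder-pos a (≤-<-trans z≤n (proj₁ rest-between))
      (between-not-coin cur l lk (proj₁ rest-between) (proj₂ rest-between))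
  c≥3 : 3 ≤ c
  c≥3 = ≤-trans (s≤s (≤-<-trans (coin-pos cur i) (increasing i j i<j))) aj<c
  grd≥3 : 3 ≤ grd a c
  grd≥3 = grd-≥3 a c≥3 rest-pos rest₂-pos
  grd≤2 : grd a c ≤ 2
  grd≤2 = grd-≤-rep a ord (≤-<-trans z≤n aj<c) (i ∷ m ∷ []) (cong (a i +_) (+-identityʳ (a m)))

lemma5p1 : (k : ℕ) (a : Fin (suc k) → ℕ) → IsCurrency k a → Orderly a →
    (i j l m : Fin (suc k)) → toℕ i < toℕ j → toℕ l < toℕ m →
    (lm : toℕ l < k) →
    a m ∸ a (fromℕ< (s≤s lm)) < a j ∸ a i →
    a j ∸ a i < a m ∸ a l →
    Σ (toℕ j < k) λ jk → a (fromℕ< (s≤s jk)) ≤ a i + a m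
lemma5p1 k a cur ord i j l m i<j _ lk lo hi with toℕ j <? k
... | no j≮k = contradiction j-is-last (coin-above-exceeds cur ord i j l m i<j lk lo hi)
  where
  j-is-last : ∀ u → toℕ j < toℕ u → a i + a m < a u
  j-is-last u j<u = contradiction (<-≤-trans j<u (s≤s⁻¹ (toℕ<n u))) j≮k
... | yes jk with a (fromℕ< (s≤s jk)) ≤? a i + a m
...   | yes next≤c = jk , next≤c
...   | no  next≰c = contradiction later-exceed (coin-above-exceeds cur ord i j l m i<j lk lo hi)
  where
  later-exceed : ∀ u → toℕ j < toℕ u → a i + a m < a u
  later-exceed u j<u = <-≤-trans (≰⇒> next≰c) (next-≤ cur j jk u j<u)
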